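{- There are infinitely many binary words that are simultaneously extremal overlap-free, irreducible overlap-free, and delicate overlap-free.
   Context: Words are finite strings over the binary alphabet $\{0,1\}$. A factor of a word is a contiguous subword. An overlap is a word of the form $xYxYx$ where $x$ is a letter and $Y$ is a (possibly empty) word; a word is overlap-free if none of its factors is an overlap. An extremal overlap-free word is an overlap-free word $w$ such that for every factorization $w = uv$ (with $u$ or $v$ possibly empty) and every letter $a\in\{0,1\}$, the word $uav$ contains an overlap. A letter of a word is interior if it is neither the first nor the last letter. An irreducible overlap-free word is an overlap-free word of length at least $3$ such that removing any one of its interior letters yields a word containing an overlap. A delicate overlap-free word is a nonempty overlap-free word such that changing any single one of its letters to the other letter yields a word containing an overlap. -}

module Defs where

open import Data.Bool using (Bool; not)
open import Data.List using (List; []; _∷_; _++_; length; [_])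
open import Data.Nat using (ℕ; suc; _≤_; _<_)
open import Data.Product using (Σ; ∃; _×_; _,_)
open import Relation.Binary.PropositionalEquality using (_≡_)
open import Relation.Nullary using (¬_)

-- Binary words: lists over Bool (false = 0, true = 1).
Word : Set
Word = List Bool

Factor : Word → Word → Set
Factor f w = ∃ λ u → ∃ λ v → w ≡ u ++ f ++ v

IsOverlap : Word → Set
IsOverlap z = ∃ λ (x : Bool) → ∃ λ (Y : Word) → z ≡ x ∷ Y ++ x ∷ Y ++ [ x ]

ContainsOverlap : Word → Set
ContainsOverlap w = ∃ λ z → Factor z w × IsOverlap z

OverlapFree : Word → Set
OverlapFree w = ¬ ContainsOverlap w

Extremal : Word → Set
Extremal w = OverlapFree w ×
  ((u v : Word) → w ≡ u ++ v → (a : Bool) → ContainsOverlap (u ++ a ∷ v))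

Irreducible : Word → Set
Irreducible w = OverlapFree w × 3 ≤ length w ×
  ((u v : Word) (b : Bool) → w ≡ u ++ b ∷ v → 1 ≤ length u → 1 ≤ length v →
     ContainsOverlap (u ++ v))

Delicate : Word → Set
Delicate w = OverlapFree w × 1 ≤ length w ×
  ((u v : Word) (b : Bool) → w ≡ u ++ b ∷ v → ContainsOverlap (u ++ not b ∷ v))

-- Take w = μᵏ(00110011) with μ the Thue–Morse morphism 0 ↦ 01, 1 ↦ 10 and k ≥ 3. The seed is
-- overlap-free by inspection, and μ reflects overlaps: an overlap in μ y has even period
-- (odd periods clash with the pairs b (not b) at even positions) and then halves to an overlap
-- in y. Write w = μ²(y) with y = μ(y′) overlap-free. An edit strictly inside w falls into the
-- block μ²(b) of some letter b of y; its neighbours a, c in y are not all equal to b (no cube in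
-- y), and at the ends of y the neighbour is not b since y is a μ-image. A finite search shows
-- that the edit already creates an overlap inside μ²(a b c). Insertions at the two ends are
-- settled by the shape w = X X with X = Z Z Z̄ Z̄, Z = μᵏ(0), Z̄ = μᵏ(1).

module Submission where

open import Defs
open import Data.Bool using (Bool; true; false; not)
open import Data.Bool.Properties using (not-involutive; not-injective; not-¬; ¬-not)
import Data.Bool.Properties as Bool
open import Data.Empty using (⊥-elim)
open import Data.List using (List; []; _∷_; _++_; _∷ʳ_; [_]; length; take; drop; map; concatMap)
open import Data.List.Properties
  using ( ++-assoc; ++-identityʳ; ++-conicalʳ; ++-monoid; length-++; map-++; concatMap-++
        ; ∷-injective; ∷-injectiveˡ; ∷-injectiveʳ; ∷ʳ-injective; ≡-dec)
open import Data.List.Reverse using (Reverse; []; _∶_∶ʳ_; reverseView)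
open import Data.Nat using (ℕ; zero; suc; pred; _+_; _≤_; _<_; z≤n; s≤s; _<?_; _≤?_)
open import Data.Nat.GeneralisedArithmetic using (fold)
open import Data.Nat.Properties
open import Data.Nat.Tactic.RingSolver using (solve-∀)
open import Data.Product using (∃; ∃₂; _×_; _,_)
open import Data.Sum using (_⊎_; inj₁; inj₂; [_,_]′)
open import Data.Unit using (⊤; tt)
open import Function using (_∘_; case_of_)
open import Relation.Binary.PropositionalEquality hiding ([_])
open import Relation.Nullary using (¬_; Dec; yes; no)
open import Relation.Nullary.Decidable using (map′; ¬?; _×-dec_; _⊎-dec_; _→-dec_; from-yes; from-no)
open import Tactic.MonoidSolver using (solve)

overlapWord : Bool → Word → Word
overlapWord x Y = x ∷ Y ++ x ∷ Y ++ [ x ]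

containsOverlap-infix : ∀ u {z} v → ContainsOverlap z → ContainsOverlap (u ++ z ++ v)
containsOverlap-infix u v (o , (u′ , v′ , refl) , isOverlap) =
  o , (u ++ u′ , v′ ++ v , solve (++-monoid Bool)) , isOverlap

containsOverlap-window : ∀ P l U E r S → ContainsOverlap (l ++ U ++ E ++ r) →
                         ContainsOverlap ((P ++ l) ++ U ++ E ++ r ++ S)
containsOverlap-window P l U E r S c = subst ContainsOverlap (regroup P l U E r S) (containsOverlap-infix P S c)
  where
  regroup : ∀ P l U E r S → P ++ (l ++ U ++ E ++ r) ++ S ≡ (P ++ l) ++ U ++ E ++ r ++ S
  regroup P l U E r S = solve (++-monoid Bool)

∷-square-overlap : ∀ a Y R → ContainsOverlap (a ∷ (Y ∷ʳ a) ++ (Y ∷ʳ a) ++ R)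
∷-square-overlap a Y R = overlapWord a Y , ([] , R , cong (a ∷_) (regroup Y [ a ] R)) , a , Y , refl
  where
  regroup : ∀ (Y X R : Word) → (Y ++ X) ++ (Y ++ X) ++ R ≡ (Y ++ X ++ Y ++ X) ++ R
  regroup Y X R = solve (++-monoid Bool)

square-∷ʳ-overlap : ∀ P a Y → ContainsOverlap (P ++ (a ∷ Y) ++ (a ∷ Y) ++ [ a ])
square-∷ʳ-overlap P a Y = overlapWord a Y , (P , [] , cong (P ++_) (sym (++-identityʳ _))) , a , Y , refl

infixl 20 _!_
_!_ : Word → ℕ → Bool
[]      ! _     = false
(x ∷ w) ! zero  = x
(x ∷ w) ! suc i = w ! i

!-++ʳ : ∀ (u r : Word) j → (u ++ r) ! (length u + j) ≡ r ! j
!-++ʳ []      r j = refl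
!-++ʳ (x ∷ u) r j = !-++ʳ u r j

!-++ˡ : ∀ (u r : Word) {j} → j < length u → (u ++ r) ! j ≡ u ! j
!-++ˡ (x ∷ u) r {zero}  _         = refl
!-++ˡ (x ∷ u) r {suc j} (s≤s j<u) = !-++ˡ u r j<u

HasPeriod : Word → ℕ → ℕ → Set
HasPeriod w s p = ∀ j → j ≤ p → w ! (s + j) ≡ w ! (s + j + p)

-- The factor of length 2p + 1 starting at position s is an overlap of period p.
OverlapAt : Word → ℕ → ℕ → Set
OverlapAt w s p = 0 < p × s + (p + p) < length w × HasPeriod w s p

overlapAt-++ˡ : ∀ u {w s p} → OverlapAt w s p → OverlapAt (u ++ w) (length u + s) p
overlapAt-++ˡ u {w} {s} {p} (0<p , bound , period) = 0<p , bound′ , period′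
  where
  bound′ : length u + s + (p + p) < length (u ++ w)
  bound′ = subst₂ _<_ (sym (+-assoc (length u) s _)) (sym (length-++ u)) (+-monoʳ-< (length u) bound)
  period′ : HasPeriod (u ++ w) (length u + s) p
  period′ j j≤p = begin
    (u ++ w) ! (length u + s + j)       ≡⟨ cong ((u ++ w) !_) (+-assoc (length u) s j) ⟩
    (u ++ w) ! (length u + (s + j))     ≡⟨ !-++ʳ u w (s + j) ⟩
    w ! (s + j)                         ≡⟨ period j j≤p ⟩
    w ! (s + j + p)                     ≡⟨ !-++ʳ u w (s + j + p) ⟨
    (u ++ w) ! (length u + (s + j + p)) ≡⟨ cong ((u ++ w) !_) (reassoc (length u) s j p) ⟩
    (u ++ w) ! (length u + s + j + p)   ∎
    where
    open ≡-Reasoning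
    reassoc : ∀ a b c d → a + (b + c + d) ≡ a + b + c + d
    reassoc = solve-∀

length-overlapWord : ∀ x Y → length (overlapWord x Y) ≡ suc (suc (length Y) + suc (length Y))
length-overlapWord x Y = cong suc (begin
  length (Y ++ x ∷ Y ++ [ x ])          ≡⟨ length-++ Y ⟩
  length Y + suc (length (Y ++ [ x ]))  ≡⟨ cong (λ n → length Y + suc n) (length-++ Y) ⟩
  length Y + suc (length Y + 1)         ≡⟨ +-suc (length Y) _ ⟩
  suc (length Y + (length Y + 1))       ≡⟨ cong (λ n → suc (length Y + n)) (+-comm (length Y) 1) ⟩
  suc (length Y) + suc (length Y)       ∎)
  where open ≡-Reasoning

overlapAt-overlapWord : ∀ x Y v → OverlapAt (overlapWord x Y ++ v) 0 (suc (length Y))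
overlapAt-overlapWord x Y v = s≤s z≤n , bound , period
  where
  q = x ∷ Y
  bound : length q + length q < length (overlapWord x Y ++ v)
  bound = subst (length q + length q <_)
                (sym (trans (length-++ (overlapWord x Y)) (cong (_+ length v) (length-overlapWord x Y))))
                (m≤m+n _ _)
  qx = q ++ [ x ]
  j<qx : ∀ {j} → j ≤ length q → j < length qx
  j<qx {j} j≤q = s≤s (subst (j ≤_) (trans (+-comm 1 (length Y)) (sym (length-++ Y))) j≤q)
  regroup : ∀ (Y X v : Word) → (Y ++ X ++ Y ++ X) ++ v ≡ (Y ++ X) ++ (Y ++ X) ++ v
  regroup Y X v = solve (++-monoid Bool)
  regroup′ : ∀ (Y X v : Word) → (Y ++ X ++ Y ++ X) ++ v ≡ Y ++ (X ++ Y ++ X) ++ v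
  regroup′ Y X v = solve (++-monoid Bool)
  period : HasPeriod (overlapWord x Y ++ v) 0 (length q)
  period j j≤q = begin
    (overlapWord x Y ++ v) ! j               ≡⟨ cong (_! j) (cong (x ∷_) (regroup Y [ x ] v)) ⟩
    (qx ++ (Y ++ [ x ]) ++ v) ! j            ≡⟨ !-++ˡ qx _ (j<qx j≤q) ⟩
    qx ! j                                   ≡⟨ !-++ˡ qx v (j<qx j≤q) ⟨
    (qx ++ v) ! j                            ≡⟨ !-++ʳ q (qx ++ v) j ⟨
    (q ++ qx ++ v) ! (length q + j)          ≡⟨ cong₂ _!_ (cong (x ∷_) (sym (regroup′ Y [ x ] v))) (+-comm (length q) j) ⟩
    (overlapWord x Y ++ v) ! (j + length q)  ∎
    where open ≡-Reasoning

containsOverlap⇒overlapAt : ∀ {w} → ContainsOverlap w → ∃₂ (OverlapAt w)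
containsOverlap⇒overlapAt (_ , (u , v , refl) , x , Y , refl) =
  length u + 0 , suc (length Y) , overlapAt-++ˡ u (overlapAt-overlapWord x Y v)

μ : Word → Word
μ = concatMap (λ b → b ∷ not b ∷ [])

length-μ : ∀ w → length (μ w) ≡ length w + length w
length-μ []      = refl
length-μ (x ∷ w) = cong suc (trans (cong suc (length-μ w)) (sym (+-suc (length w) (length w))))

μ-even : ∀ w i → μ w ! (i + i) ≡ w ! i
μ-even []      i       = refl
μ-even (x ∷ w) zero    = refl
μ-even (x ∷ w) (suc i) = trans (cong (μ (x ∷ w) !_) (cong suc (+-suc i i))) (μ-even w i)

μ-odd : ∀ w {i} → i < length w → μ w ! suc (i + i) ≡ not (w ! i)
μ-odd (x ∷ w) {zero}  _         = refl
μ-odd (x ∷ w) {suc i} (s≤s i<w) = trans (cong (μ (x ∷ w) !_) (cong (suc ∘ suc) (+-suc i i))) (μ-odd w i<w)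

half-< : ∀ {a b} → a + a < b + b → a < b
half-< a+a<b+b = ≰⇒> λ b≤a → <⇒≱ a+a<b+b (+-mono-≤ b≤a b≤a)

μ-pair : ∀ w {i} → i + i < length (μ w) → μ w ! suc (i + i) ≡ not (μ w ! (i + i))
μ-pair w {i} i+i<μw =
  trans (μ-odd w (half-< (subst (i + i <_) (length-μ w) i+i<μw))) (cong not (sym (μ-even w i)))

μ-head : ∀ y′ {b c s} → μ y′ ≡ b ∷ c ∷ s → c ≡ not b
μ-head (x ∷ y′) refl = refl

μ-∷ʳ : ∀ y x → μ (y ∷ʳ x) ≡ (μ y ∷ʳ x) ∷ʳ not x
μ-∷ʳ y x = trans (concatMap-++ _ y [ x ]) (sym (++-assoc (μ y) [ x ] [ not x ]))

μ-last : ∀ y′ {p a b} → μ y′ ≡ (p ∷ʳ a) ∷ʳ b → b ≡ not a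
μ-last y′ {p} e with reverseView y′
... | []          = case ++-conicalʳ (p ∷ʳ _) [ _ ] (sym e) of λ ()
... | y″ ∶ _ ∶ʳ x with ∷ʳ-injective (μ y″ ∷ʳ x) (p ∷ʳ _) (trans (sym (μ-∷ʳ y″ x)) e)
... | μy″x≡ , refl with ∷ʳ-injective (μ y″) p μy″x≡
...   | _ , refl = refl

μ-≢-[_] : ∀ y′ {b} → μ y′ ≢ [ b ]
μ-≢-[_] (x ∷ _) ()

block : Bool → Word
block b = μ (μ [ b ])

μ²≡concatMap-block : ∀ y → μ (μ y) ≡ concatMap block y
μ²≡concatMap-block []      = refl
μ²≡concatMap-block (b ∷ y) = cong (block b ++_) (μ²≡concatMap-block y)

even-or-odd : ∀ n → ∃ (λ t → n ≡ t + t) ⊎ ∃ (λ t → n ≡ suc (t + t))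
even-or-odd zero = inj₁ (0 , refl)
even-or-odd (suc n) with even-or-odd n
... | inj₁ (t , n≡t+t)   = inj₂ (t , cong suc n≡t+t)
... | inj₂ (t , n≡1+t+t) = inj₁ (suc t , cong suc (trans n≡1+t+t (sym (+-suc t t))))

alternating : ∀ (f : ℕ → Bool) q → (∀ i → i < suc (q + q) → f (suc i) ≡ not (f i)) →
              f (suc (q + q)) ≡ not (f 0)
alternating f zero    flips = flips 0 (s≤s z≤n)
alternating f (suc q) flips = begin
  f (suc (suc q + suc q))      ≡⟨ cong (f ∘ suc ∘ suc) (+-suc q q) ⟩
  f (suc (suc (suc (q + q))))  ≡⟨ alternating (f ∘ suc ∘ suc) q (λ i i<n → flips (suc (suc i)) (shift i<n)) ⟩
  not (f 2)                    ≡⟨ cong not (flips 1 (s≤s (s≤s z≤n))) ⟩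
  not (not (f 1))              ≡⟨ not-involutive _ ⟩
  f 1                          ≡⟨ flips 0 (s≤s z≤n) ⟩
  not (f 0)                    ∎
  where
  open ≡-Reasoning
  shift : ∀ {i} → i < suc (q + q) → suc (suc i) < suc (suc q + suc q)
  shift {i} i<n = s≤s (s≤s (subst (suc i ≤_) (sym (+-suc q q)) i<n))

μ-noOddPeriod : ∀ y {s q} → ¬ OverlapAt (μ y) s (suc (q + q))
μ-noOddPeriod y {s} {q} (_ , bound , period) = not-¬ refl (begin
  f 0                ≡⟨ period 0 z≤n ⟩
  μ y ! (s + 0 + p)  ≡⟨ cong (λ k → μ y ! (k + p)) (+-identityʳ s) ⟩
  f p                ≡⟨ alternating f q differ ⟩
  not (f 0)          ∎)
  where
  open ≡-Reasoning
  p = suc (q + q)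
  f : ℕ → Bool
  f j = μ y ! (s + j)
  pairAt : ∀ m → suc (m + m) ≤ s + (p + p) → μ y ! suc (m + m) ≡ not (μ y ! (m + m))
  pairAt m le = μ-pair y {m} (<-trans (n<1+n _) (≤-<-trans le bound))
  differ : ∀ i → i < p → f (suc i) ≡ not (f i)
  differ i i<p with even-or-odd (s + i)
  ... | inj₁ (t , s+i≡t+t) = begin
    μ y ! (s + suc i)    ≡⟨ cong (μ y !_) s+1+i≡ ⟩
    μ y ! suc (t + t)    ≡⟨ pairAt t (subst (_≤ s + (p + p)) s+1+i≡ (+-monoʳ-≤ s (≤-trans i<p (m≤m+n p p)))) ⟩
    not (μ y ! (t + t))  ≡⟨ cong (not ∘ (μ y !_)) (sym s+i≡t+t) ⟩
    not (f i)            ∎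
    where
    s+1+i≡ : s + suc i ≡ suc (t + t)
    s+1+i≡ = trans (+-suc s i) (cong suc s+i≡t+t)
  ... | inj₂ (t , s+i≡1+t+t) = begin
    μ y ! (s + suc i)        ≡⟨ period (suc i) i<p ⟩
    μ y ! (s + suc i + p)    ≡⟨ cong (μ y !_) odd≡ ⟩
    μ y ! suc (m + m)        ≡⟨ pairAt m (subst (_≤ s + (p + p)) odd≡ (≤-trans (≤-reflexive (+-assoc s (suc i) p))
                                                                                (+-monoʳ-≤ s (+-monoˡ-≤ p i<p)))) ⟩
    not (μ y ! (m + m))      ≡⟨ cong (not ∘ (μ y !_)) (sym s+i+p≡m+m) ⟩
    not (μ y ! (s + i + p))  ≡⟨ cong not (period i (<⇒≤ i<p)) ⟨
    not (f i)                ∎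
    where
    m = suc (t + q)
    s+i+p≡m+m : s + i + p ≡ m + m
    s+i+p≡m+m = trans (cong (_+ p) s+i≡1+t+t) (double-+ t q)
      where
      double-+ : ∀ t q → suc (t + t) + suc (q + q) ≡ suc (t + q) + suc (t + q)
      double-+ = solve-∀
    odd≡ : s + suc i + p ≡ suc (m + m)
    odd≡ = trans (cong (_+ p) (+-suc s i)) (cong suc s+i+p≡m+m)

μ-desubstitute : ∀ y {t q} → OverlapAt (μ y) (t + t) (q + q) → OverlapAt y t q
μ-desubstitute y {q = zero} (() , _)
μ-desubstitute y {t} {q@(suc _)} (_ , bound , period) =
  s≤s z≤n , half-< (subst₂ _<_ (regroup t q) (length-μ y) bound) , period′
  where
  regroup : ∀ t q → t + t + ((q + q) + (q + q)) ≡ (t + (q + q)) + (t + (q + q))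
  regroup = solve-∀
  interleave : ∀ t j → (t + j) + (t + j) ≡ t + t + (j + j)
  interleave = solve-∀
  interleave₃ : ∀ t j q → t + t + (j + j) + (q + q) ≡ (t + j + q) + (t + j + q)
  interleave₃ = solve-∀
  period′ : HasPeriod y t q
  period′ j j≤q = begin
    y ! (t + j)                        ≡⟨ μ-even y (t + j) ⟨
    μ y ! ((t + j) + (t + j))          ≡⟨ cong (μ y !_) (interleave t j) ⟩
    μ y ! (t + t + (j + j))            ≡⟨ period (j + j) (+-mono-≤ j≤q j≤q) ⟩
    μ y ! (t + t + (j + j) + (q + q))  ≡⟨ cong (μ y !_) (interleave₃ t j q) ⟩
    μ y ! ((t + j + q) + (t + j + q))  ≡⟨ μ-even y (t + j + q) ⟩
    y ! (t + j + q)                    ∎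
    where open ≡-Reasoning

-- μ y consists of pairs b (not b) at even positions, so the letter before an odd position
-- is the complement of the letter at it, and likewise one period further on.
μ-overlapAt-oddStart : ∀ y {t q} → OverlapAt (μ y) (suc (t + t)) (q + q) → OverlapAt (μ y) (t + t) (q + q)
μ-overlapAt-oddStart y {t} {q} (0<p , bound , period) = 0<p , <-trans (n<1+n _) bound , period′
  where
  open ≡-Reasoning
  p = q + q
  m = t + q
  end≡ : suc (t + t) + p ≡ suc (m + m)
  end≡ = cong suc (shuffle t q)
    where
    shuffle : ∀ t q → t + t + (q + q) ≡ (t + q) + (t + q)
    shuffle = solve-∀
  m+m<L : m + m < length (μ y)
  m+m<L = ≤-<-trans (≤-trans (n≤1+n (m + m)) (≤-trans (≤-reflexive (sym end≡)) (+-monoʳ-≤ (suc (t + t)) (m≤m+n p p))))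
                    bound
  period′ : HasPeriod (μ y) (t + t) p
  period′ zero _ = not-injective (begin
    not (μ y ! (t + t + 0))        ≡⟨ cong (not ∘ (μ y !_)) (+-identityʳ (t + t)) ⟩
    not (μ y ! (t + t))            ≡⟨ μ-pair y {t} (<-trans (n<1+n _) (m+n≤o⇒m≤o (suc (suc (t + t))) bound)) ⟨
    μ y ! suc (t + t)              ≡⟨ cong (μ y !_) (+-identityʳ _) ⟨
    μ y ! (suc (t + t) + 0)        ≡⟨ period 0 z≤n ⟩
    μ y ! (suc (t + t) + 0 + p)    ≡⟨ cong (λ k → μ y ! (k + p)) (+-identityʳ (suc (t + t))) ⟩
    μ y ! (suc (t + t) + p)        ≡⟨ cong (μ y !_) end≡ ⟩
    μ y ! suc (m + m)              ≡⟨ μ-pair y {m} m+m<L ⟩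
    not (μ y ! (m + m))            ≡⟨ cong (not ∘ (μ y !_)) (trans (cong (_+ p) (+-identityʳ (t + t))) (cong pred end≡)) ⟨
    not (μ y ! (t + t + 0 + p))    ∎)
  period′ (suc j) j<p = begin
    μ y ! (t + t + suc j)          ≡⟨ cong (μ y !_) (+-suc (t + t) j) ⟩
    μ y ! (suc (t + t) + j)        ≡⟨ period j (<⇒≤ j<p) ⟩
    μ y ! (suc (t + t) + j + p)    ≡⟨ cong (λ k → μ y ! (k + p)) (+-suc (t + t) j) ⟨
    μ y ! (t + t + suc j + p)      ∎

μ-reflectsOverlap : ∀ y {s p} → OverlapAt (μ y) s p → ∃₂ (OverlapAt y)
μ-reflectsOverlap y {s} {p} o with even-or-odd p | even-or-odd s
... | inj₂ (q , refl) | _               = ⊥-elim (μ-noOddPeriod y {s} {q} o)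
... | inj₁ (q , refl) | inj₁ (t , refl) = t , q , μ-desubstitute y {t} {q} o
... | inj₁ (q , refl) | inj₂ (t , refl) = t , q , μ-desubstitute y {t} {q} (μ-overlapAt-oddStart y {t} {q} o)

overlapAt? : ∀ w s p → Dec (OverlapAt w s p)
overlapAt? w s p = 0 <? p ×-dec suc (s + (p + p)) ≤? length w ×-dec hasPeriod?
  where
  hasPeriod? : Dec (HasPeriod w s p)
  hasPeriod? = map′ (λ h j j≤p → h (s≤s j≤p)) (λ h {j} j<1+p → h j (≤-pred j<1+p))
                    (allUpTo? (λ j → w ! (s + j) Bool.≟ w ! (s + j + p)) (suc p))

someOverlapAt? : ∀ w → Dec (∃₂ (OverlapAt w))
someOverlapAt? w = map′ (λ (s , _ , p , _ , o) → s , p , o) bounded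
  (anyUpTo? (λ s → anyUpTo? (overlapAt? w s) (length w)) (length w))
  where
  bounded : ∃₂ (OverlapAt w) → ∃ λ s → s < length w × ∃ λ p → p < length w × OverlapAt w s p
  bounded (s , p , o@(_ , bound , _)) =
    s , ≤-<-trans (m≤m+n s (p + p)) bound , p , ≤-<-trans (≤-trans (m≤m+n p p) (m≤n+m (p + p) s)) bound , o

take-length-++ : ∀ (u v : Word) → take (length u) (u ++ v) ≡ u
take-length-++ []      v = refl
take-length-++ (x ∷ u) v = cong (x ∷_) (take-length-++ u v)

drop-length-++ : ∀ (u v : Word) → drop (length u) (u ++ v) ≡ v
drop-length-++ []      v = refl
drop-length-++ (x ∷ u) v = drop-length-++ u v

≡-++-drop : ∀ {w} (z v : Word) → w ≡ z ++ v → w ≡ z ++ drop (length z) w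
≡-++-drop z v refl = cong (z ++_) (sym (drop-length-++ z v))

OverlapPrefix : Word → Set
OverlapPrefix w = ∃ λ z → ∃ λ v → w ≡ z ++ v × IsOverlap z

overlapPrefix? : (w : Word) → Dec (OverlapPrefix w)
overlapPrefix? []      = no λ { (_ , _ , () , _ , _ , refl) }
overlapPrefix? (x ∷ r) =
  map′ found complete (anyUpTo? (λ m → ≡-dec Bool._≟_ (x ∷ r) (candidate m)) (suc (length r)))
  where
  withPrefix : Word → Word
  withPrefix z = z ++ drop (length z) (x ∷ r)
  candidate : ℕ → Word
  candidate m = withPrefix (overlapWord x (take m r))

  found : ∃ (λ m → m < suc (length r) × x ∷ r ≡ candidate m) → OverlapPrefix (x ∷ r)
  found (m , _ , e) = _ , _ , e , x , take m r , refl

  complete : OverlapPrefix (x ∷ r) → ∃ λ m → m < suc (length r) × x ∷ r ≡ candidate m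
  complete (_ , v , e , _ , Y , refl) with ∷-injective e
  ... | refl , r≡ =
    length Y , s≤s Y≤r , subst (λ Y′ → x ∷ r ≡ withPrefix (overlapWord x Y′)) (sym takeY) (≡-++-drop (overlapWord x Y) v e)
    where
    r≡Y++ : r ≡ Y ++ (x ∷ Y ++ [ x ]) ++ v
    r≡Y++ = trans r≡ (++-assoc Y _ v)
    Y≤r : length Y ≤ length r
    Y≤r = subst (length Y ≤_) (sym (trans (cong length r≡Y++) (length-++ Y))) (m≤m+n _ _)
    takeY : take (length Y) r ≡ Y
    takeY = trans (cong (take (length Y)) r≡Y++) (take-length-++ Y _)

containsOverlap? : (w : Word) → Dec (ContainsOverlap w)
containsOverlap? []      = no λ { (_ , ([] , _ , ()) , _ , _ , refl) ; (_ , (_ ∷ _ , _ , ()) , _) }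
containsOverlap? (x ∷ w) =
  map′ [ atFront , inTail ]′ split (overlapPrefix? (x ∷ w) ⊎-dec containsOverlap? w)
  where
  atFront : OverlapPrefix (x ∷ w) → ContainsOverlap (x ∷ w)
  atFront (z , v , e , isOverlap) = z , ([] , v , e) , isOverlap
  inTail : ContainsOverlap w → ContainsOverlap (x ∷ w)
  inTail (z , (u , v , e) , isOverlap) = z , (x ∷ u , v , cong (x ∷_) e) , isOverlap
  split : ContainsOverlap (x ∷ w) → OverlapPrefix (x ∷ w) ⊎ ContainsOverlap w
  split (z , ([]    , v , e) , isOverlap) = inj₁ (z , v , e , isOverlap)
  split (z , (_ ∷ u , v , e) , isOverlap) = inj₂ (z , (u , v , ∷-injectiveʳ e) , isOverlap)

seed : Word
seed = false ∷ false ∷ true ∷ true ∷ false ∷ false ∷ true ∷ true ∷ []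

thueMorse : ℕ → Word → Word
thueMorse k w = fold w μ k

thueMorse-noOverlapAt : ∀ k → ¬ ∃₂ (OverlapAt (thueMorse k seed))
thueMorse-noOverlapAt zero          = from-no (someOverlapAt? seed)
thueMorse-noOverlapAt (suc k) (_ , _ , o) = thueMorse-noOverlapAt k (μ-reflectsOverlap (thueMorse k seed) o)

thueMorse-overlapFree : ∀ k → OverlapFree (thueMorse k seed)
thueMorse-overlapFree k = thueMorse-noOverlapAt k ∘ containsOverlap⇒overlapAt

thueMorse-++ : ∀ k u v → thueMorse k (u ++ v) ≡ thueMorse k u ++ thueMorse k v
thueMorse-++ zero    u v = refl
thueMorse-++ (suc k) u v = trans (cong μ (thueMorse-++ k u v)) (concatMap-++ _ (thueMorse k u) (thueMorse k v))

thueMorse-complement : ∀ k w → thueMorse k (map not w) ≡ map not (thueMorse k w)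
thueMorse-complement zero    w = refl
thueMorse-complement (suc k) w = trans (cong μ (thueMorse-complement k w)) (μ-complement (thueMorse k w))
  where
  μ-complement : ∀ w → μ (map not w) ≡ map not (μ w)
  μ-complement []      = refl
  μ-complement (x ∷ w) = cong (λ r → not x ∷ not (not x) ∷ r) (μ-complement w)

thueMorse-head : ∀ k b → ∃ λ Z′ → thueMorse k [ b ] ≡ b ∷ Z′
thueMorse-head zero    b = [] , refl
thueMorse-head (suc k) b with thueMorse-head k b
... | Z′ , Z≡ = not b ∷ μ Z′ , cong μ Z≡

∷-as-∷ʳ : ∀ (x : Bool) w → ∃₂ λ w′ e → x ∷ w ≡ w′ ∷ʳ e
∷-as-∷ʳ x []      = [] , x , refl
∷-as-∷ʳ x (y ∷ w) with ∷-as-∷ʳ y w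
... | w′ , e , y∷w≡ = x ∷ w′ , e , cong (x ∷_) y∷w≡

thueMorse-last : ∀ k b → ∃₂ λ Z′ e → thueMorse k [ b ] ≡ Z′ ∷ʳ e
thueMorse-last k b with thueMorse-head k b
... | Z′ , Z≡ with ∷-as-∷ʳ b Z′
...   | Z″ , e , b∷Z′≡ = Z″ , e , trans Z≡ b∷Z′≡

thueMorse-length : ∀ k → suc k ≤ length (thueMorse k seed)
thueMorse-length zero    = s≤s z≤n
thueMorse-length (suc k) = subst₂ _≤_ (+-comm (suc k) 1) (sym (length-μ (thueMorse k seed)))
  (+-mono-≤ (thueMorse-length k) (≤-trans (s≤s z≤n) (thueMorse-length k)))

data Edit : Set where
  insert : Bool → Edit
  delete flip : Edit

edit : Edit → Word → Word
edit (insert a) v       = a ∷ v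
edit delete     []      = []
edit delete     (_ ∷ v) = v
edit flip       []      = []
edit flip       (b ∷ v) = not b ∷ v

all-edits? : {P : Edit → Set} → (∀ e → Dec (P e)) → Dec (∀ e → P e)
all-edits? P? =
  map′ (λ (p₀ , p₁ , p-del , p-flip) → λ { (insert false) → p₀ ; (insert true) → p₁ ; delete → p-del ; flip → p-flip })
       (λ p → p _ , p _ , p _ , p _)
       (P? (insert false) ×-dec P? (insert true) ×-dec P? delete ×-dec P? flip)

-- These rule out the edits at the junction u | v that are really edits at an end of the word:
-- an insertion at the end or next to an equal end letter, and the deletion of the end letter.
AwayFromFront : Edit → Word → Set
AwayFromFront (insert a) u = u ≢ [] × u ≢ [ a ]
AwayFromFront delete     u = 1 ≤ length u
AwayFromFront flip       u = ⊤

AwayFromBack : Edit → Word → Set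
AwayFromBack (insert a) v = v ≢ [ a ]
AwayFromBack delete     v = 2 ≤ length v
AwayFromBack flip       v = ⊤

awayFromFront? : ∀ e u → Dec (AwayFromFront e u)
awayFromFront? (insert a) u = ¬? (≡-dec Bool._≟_ u []) ×-dec ¬? (≡-dec Bool._≟_ u [ a ])
awayFromFront? delete     u = 1 ≤? length u
awayFromFront? flip       u = yes tt

awayFromBack? : ∀ e v → Dec (AwayFromBack e v)
awayFromBack? (insert a) v = ¬? (≡-dec Bool._≟_ v [ a ])
awayFromBack? delete     v = 2 ≤? length v
awayFromBack? flip       v = yes tt

record EditsCreateOverlap (l w r : Word) (Allowed : Edit → Word → Word → Set) : Set where
  constructor editsCreateOverlap
  field
    at : ∀ {i} → i < length w → ∀ e → Allowed e (take i w) (drop i w) →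
         ContainsOverlap (l ++ take i w ++ edit e (drop i w) ++ r)

editsCreateOverlap? : ∀ l w r {Allowed} → (∀ e u v → Dec (Allowed e u v)) →
                      Dec (EditsCreateOverlap l w r Allowed)
editsCreateOverlap? l w r allowed? =
  map′ editsCreateOverlap EditsCreateOverlap.at
       (allUpTo? (λ i → all-edits? (λ e → allowed? e _ _ →-dec containsOverlap? _)) (length w))

editsCreateOverlap-at : ∀ {l w r Allowed} → EditsCreateOverlap l w r Allowed →
  ∀ u d m → w ≡ u ++ d ∷ m → ∀ e → Allowed e u (d ∷ m) →
  ContainsOverlap (l ++ u ++ edit e (d ∷ m) ++ r)
editsCreateOverlap-at {l} {r = r} {Allowed} (editsCreateOverlap creates) u d m refl e =
  subst₂ (λ u′ v′ → Allowed e u′ v′ → ContainsOverlap (l ++ u′ ++ edit e v′ ++ r))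
         (take-length-++ u (d ∷ m)) (drop-length-++ u (d ∷ m))
         (creates (subst (length u <_) (sym (length-++ u)) (m<m+n (length u) (s≤s z≤n))) e)

edit-++ : ∀ e d m X → edit e ((d ∷ m) ++ X) ≡ edit e (d ∷ m) ++ X
edit-++ (insert _) d m X = refl
edit-++ delete     d m X = refl
edit-++ flip       d m X = refl

insertions-create-overlap-inside : ∀ {W} a → ContainsOverlap (W ++ [ a ]) →
  (∀ u d v → W ≡ u ++ d ∷ v → AwayFromFront (insert a) u → AwayFromBack (insert a) (d ∷ v) →
     ContainsOverlap (u ++ a ∷ d ∷ v)) →
  ∀ u v → W ≡ u ++ v → AwayFromFront (insert a) u → ContainsOverlap (u ++ a ∷ v)
insertions-create-overlap-inside a back inner u []           W≡ _ =
  subst (λ w → ContainsOverlap (w ++ [ a ])) (trans W≡ (++-identityʳ u)) back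
insertions-create-overlap-inside a back inner u (d ∷ [])     W≡ away with a Bool.≟ d
... | yes refl = subst ContainsOverlap (++-assoc u [ a ] [ a ]) (subst (λ w → ContainsOverlap (w ++ [ a ])) W≡ back)
... | no a≢d   = inner u d [] W≡ away λ e → a≢d (sym (∷-injectiveˡ e))
insertions-create-overlap-inside a back inner u (d ∷ d′ ∷ v) W≡ away = inner u d (d′ ∷ v) W≡ away λ ()

insertions-create-overlap : ∀ {W} a → ContainsOverlap (a ∷ W) → ContainsOverlap (W ++ [ a ]) →
  (∀ u d v → W ≡ u ++ d ∷ v → AwayFromFront (insert a) u → AwayFromBack (insert a) (d ∷ v) →
     ContainsOverlap (u ++ a ∷ d ∷ v)) →
  ∀ u v → W ≡ u ++ v → ContainsOverlap (u ++ a ∷ v)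
insertions-create-overlap a front back inner []           v refl = front
insertions-create-overlap a front back inner (x ∷ [])     v W≡ with a Bool.≟ x
... | yes refl = subst (ContainsOverlap ∘ (a ∷_)) W≡ front
... | no a≢x   =
  insertions-create-overlap-inside a back inner (x ∷ []) v W≡ ((λ ()) , λ e → a≢x (sym (∷-injectiveˡ e)))
insertions-create-overlap a front back inner (x ∷ x′ ∷ u) v W≡ =
  insertions-create-overlap-inside a back inner (x ∷ x′ ∷ u) v W≡ ((λ ()) , λ ())

Anywhere : Edit → Word → Word → Set
Anywhere _ _ _ = ⊤

anywhere? : ∀ e u v → Dec (Anywhere e u v)
anywhere? _ _ _ = yes tt

block-edits-inner : ∀ a b c → ¬ (a ≡ b × b ≡ c) → EditsCreateOverlap (block a) (block b) (block c) Anywhere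
block-edits-inner false false false distinct = ⊥-elim (distinct (refl , refl))
block-edits-inner false false true  _ = from-yes (editsCreateOverlap? (block false) (block false) (block true) anywhere?)
block-edits-inner false true  false _ = from-yes (editsCreateOverlap? (block false) (block true) (block false) anywhere?)
block-edits-inner false true  true  _ = from-yes (editsCreateOverlap? (block false) (block true) (block true) anywhere?)
block-edits-inner true  false false _ = from-yes (editsCreateOverlap? (block true) (block false) (block false) anywhere?)
block-edits-inner true  false true  _ = from-yes (editsCreateOverlap? (block true) (block false) (block true) anywhere?)
block-edits-inner true  true  false _ = from-yes (editsCreateOverlap? (block true) (block true) (block false) anywhere?)
block-edits-inner true  true  true  distinct = ⊥-elim (distinct (refl , refl))

block-edits-first : ∀ b → EditsCreateOverlap [] (block b) (block (not b)) (λ e u _ → AwayFromFront e u)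
block-edits-first false = from-yes (editsCreateOverlap? [] (block false) (block true) (λ e u _ → awayFromFront? e u))
block-edits-first true  = from-yes (editsCreateOverlap? [] (block true) (block false) (λ e u _ → awayFromFront? e u))

block-edits-last : ∀ a → EditsCreateOverlap (block a) (block (not a)) [] (λ e _ v → AwayFromBack e v)
block-edits-last false = from-yes (editsCreateOverlap? (block false) (block true) [] (λ e _ v → awayFromBack? e v))
block-edits-last true  = from-yes (editsCreateOverlap? (block true) (block false) [] (λ e _ v → awayFromBack? e v))

module _ {A B : Set} where

  ++-split : ∀ (xs ys u : List B) d v → xs ++ ys ≡ u ++ d ∷ v →
             (∃ λ u′ → u ≡ xs ++ u′ × ys ≡ u′ ++ d ∷ v) ⊎ (∃ λ m → xs ≡ u ++ d ∷ m × v ≡ m ++ ys)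
  ++-split []       ys u       d v e = inj₁ (u , refl , e)
  ++-split (x ∷ xs) ys []      d v e = inj₂ (xs , cong (_∷ xs) (∷-injectiveˡ e) , sym (∷-injectiveʳ e))
  ++-split (x ∷ xs) ys (z ∷ u) d v e with ∷-injective e
  ... | refl , e′ with ++-split xs ys u d v e′
  ...   | inj₁ (u′ , u≡ , ys≡) = inj₁ (u′ , cong (x ∷_) u≡ , ys≡)
  ...   | inj₂ (m , xs≡ , v≡)  = inj₂ (m , cong (x ∷_) xs≡ , v≡)

  record ImagePosition (f : A → List B) (y : List A) (u : List B) (d : B) (v : List B) : Set where
    field
      before after : List A
      letter : A
      inner₁ inner₂ : List B
      y≡ : y ≡ before ++ letter ∷ after
      image≡ : f letter ≡ inner₁ ++ d ∷ inner₂
      u≡ : u ≡ concatMap f before ++ inner₁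
      v≡ : v ≡ inner₂ ++ concatMap f after

  concatMap-position : ∀ (f : A → List B) y u d v → concatMap f y ≡ u ++ d ∷ v → ImagePosition f y u d v
  concatMap-position f []      []      d v ()
  concatMap-position f []      (_ ∷ _) d v ()
  concatMap-position f (b ∷ y) u       d v e with ++-split (f b) (concatMap f y) u d v e
  ... | inj₂ (m , fb≡ , v≡) = record { before = [] ; after = y ; letter = b ; inner₁ = u ; inner₂ = m
                                     ; y≡ = refl ; image≡ = fb≡ ; u≡ = refl ; v≡ = v≡ }
  ... | inj₁ (u′ , u≡ , rest≡) = record
    { before = b ∷ before ; after = after ; letter = letter ; inner₁ = inner₁ ; inner₂ = inner₂
    ; y≡ = cong (b ∷_) y≡ ; image≡ = image≡
    ; u≡ = trans u≡ (trans (cong (f b ++_) u′≡) (sym (++-assoc (f b) (concatMap f before) inner₁)))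
    ; v≡ = v≡
    }
    where open ImagePosition (concatMap-position f y u′ d v rest≡) renaming (u≡ to u′≡)

concatMap-∷ʳ : ∀ (f : Bool → Word) p a → concatMap f (p ∷ʳ a) ≡ concatMap f p ++ f a
concatMap-∷ʳ f p a = trans (concatMap-++ f p [ a ]) (cong (concatMap f p ++_) (++-identityʳ (f a)))

μ³-edit-interior : ∀ y′ → OverlapFree (μ y′) → ∀ e u d v → μ (μ (μ y′)) ≡ u ++ d ∷ v →
                   AwayFromFront e u → AwayFromBack e (d ∷ v) → ContainsOverlap (u ++ edit e (d ∷ v))
μ³-edit-interior y′ free e u d v W≡ front back
  with concatMap-position block (μ y′) u d v (trans (sym (μ²≡concatMap-block (μ y′))) W≡)
... | record { before = before ; after = after ; letter = b ; inner₁ = u₁ ; inner₂ = m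
             ; y≡ = y≡ ; image≡ = image≡ ; u≡ = refl ; v≡ = refl } =
  subst ContainsOverlap (sym (junction (concatMap block before) (concatMap block after)))
        (around (reverseView before) after y≡ front back)
  where
  E = edit e (d ∷ m)
  junction : ∀ B A → (B ++ u₁) ++ edit e (d ∷ m ++ A) ≡ B ++ u₁ ++ E ++ A
  junction B A = trans (++-assoc B u₁ _) (cong (λ w → B ++ u₁ ++ w) (edit-++ e d m A))
  local : ∀ l r {Allowed} → EditsCreateOverlap l (block b) r Allowed → Allowed e u₁ (d ∷ m) →
          ContainsOverlap (l ++ u₁ ++ E ++ r)
  local _ _ creates = editsCreateOverlap-at creates u₁ d m image≡ e
  around : ∀ {p} → Reverse p → ∀ s → μ y′ ≡ p ++ b ∷ s →
           AwayFromFront e (concatMap block p ++ u₁) → AwayFromBack e (d ∷ m ++ concatMap block s) →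
           ContainsOverlap (concatMap block p ++ u₁ ++ E ++ concatMap block s)
  around []              []      y≡ _     _    = ⊥-elim (μ-≢-[ y′ ] y≡)
  around []              (c ∷ s) y≡ front _    with μ-head y′ y≡
  ... | refl = containsOverlap-window [] [] u₁ E (block (not b)) (concatMap block s)
                 (local [] (block (not b)) (block-edits-first b) front)
  around (p ∶ _ ∶ʳ a)   []      y≡ _     back with μ-last y′ y≡
  ... | refl = subst (λ B → ContainsOverlap (B ++ u₁ ++ E ++ [])) (sym (concatMap-∷ʳ block p a))
                 (containsOverlap-window (concatMap block p) (block a) u₁ E [] []
                    (local (block a) [] (block-edits-last a) back′))
    where
    back′ : AwayFromBack e (d ∷ m)
    back′ = subst (AwayFromBack e) (cong (d ∷_) (++-identityʳ m)) back
  around (p ∶ _ ∶ʳ a)   (c ∷ s) y≡ _     _    =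
    subst (λ B → ContainsOverlap (B ++ u₁ ++ E ++ block c ++ concatMap block s)) (sym (concatMap-∷ʳ block p a))
      (containsOverlap-window (concatMap block p) (block a) u₁ E (block c) (concatMap block s)
        (local (block a) (block c) (block-edits-inner a b c noCube) tt))
    where
    noCube : ¬ (a ≡ b × b ≡ c)
    noCube (refl , refl) = free (overlapWord a [] , (p , s , trans y≡ (++-assoc p [ a ] _)) , a , [] , refl)

module Seed (k : ℕ) where

  Z Z̄ X : Word
  Z = thueMorse k [ false ]
  Z̄ = thueMorse k [ true ]
  X = Z ++ Z ++ Z̄ ++ Z̄

  W≡X++X : thueMorse k seed ≡ X ++ X
  W≡X++X = begin
    thueMorse k (quarter ++ quarter)            ≡⟨ thueMorse-++ k quarter quarter ⟩
    thueMorse k quarter ++ thueMorse k quarter  ≡⟨ cong₂ _++_ quarter≡ quarter≡ ⟩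
    X ++ X                                      ∎
    where
    open ≡-Reasoning
    quarter = false ∷ false ∷ true ∷ true ∷ []
    quarter≡ : thueMorse k quarter ≡ X
    quarter≡ = trans (thueMorse-++ k [ false ] _) (cong (Z ++_) (trans (thueMorse-++ k [ false ] _) (cong (Z ++_)
               (thueMorse-++ k [ true ] [ true ]))))

  insertFront : ∀ a → ContainsOverlap (a ∷ thueMorse k seed)
  insertFront a with thueMorse-last k false
  ... | Z′ , e , Z≡ with a Bool.≟ e
  ...   | yes refl = subst (ContainsOverlap ∘ (a ∷_)) (sym W≡) (∷-square-overlap a Z′ (Z̄ ++ Z̄ ++ X))
    where
    regroup : ∀ (Z Z̄ X : Word) → (Z ++ Z ++ Z̄ ++ Z̄) ++ X ≡ Z ++ Z ++ Z̄ ++ Z̄ ++ X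
    regroup Z Z̄ X = solve (++-monoid Bool)
    W≡ : thueMorse k seed ≡ (Z′ ∷ʳ a) ++ (Z′ ∷ʳ a) ++ Z̄ ++ Z̄ ++ X
    W≡ = trans W≡X++X (trans (regroup Z Z̄ X) (cong (λ z → z ++ z ++ Z̄ ++ Z̄ ++ X) Z≡))
  ...   | no a≢e with ¬-not a≢e
  ...     | refl = subst (ContainsOverlap ∘ (a ∷_)) (sym W≡) (∷-square-overlap a X′ [])
    where
    X′ = Z ++ Z ++ Z̄ ++ map not Z′
    regroup : ∀ (Z Z̄ M N : Word) → Z ++ Z ++ Z̄ ++ M ++ N ≡ (Z ++ Z ++ Z̄ ++ M) ++ N
    regroup Z Z̄ M N = solve (++-monoid Bool)
    Z̄≡ : Z̄ ≡ map not Z′ ∷ʳ a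
    Z̄≡ = trans (thueMorse-complement k [ false ]) (trans (cong (map not) Z≡) (map-++ not Z′ [ e ]))
    X≡ : X ≡ X′ ∷ʳ a
    X≡ = trans (cong (λ z → Z ++ Z ++ Z̄ ++ z) Z̄≡) (regroup Z Z̄ (map not Z′) [ a ])
    W≡ : thueMorse k seed ≡ (X′ ∷ʳ a) ++ (X′ ∷ʳ a) ++ []
    W≡ = trans W≡X++X (trans (cong₂ _++_ X≡ X≡) (cong ((X′ ∷ʳ a) ++_) (sym (++-identityʳ _))))

  insertBack : ∀ a → ContainsOverlap (thueMorse k seed ++ [ a ])
  insertBack false with thueMorse-head k false
  ... | Z″ , Z≡ = subst ContainsOverlap (sym W++≡) (square-∷ʳ-overlap [] false Y)
    where
    Y = Z″ ++ Z ++ Z̄ ++ Z̄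
    X≡ : X ≡ false ∷ Y
    X≡ = cong (_++ Z ++ Z̄ ++ Z̄) Z≡
    W++≡ : thueMorse k seed ++ [ false ] ≡ (false ∷ Y) ++ (false ∷ Y) ++ [ false ]
    W++≡ = trans (cong (_++ [ false ]) (trans W≡X++X (cong₂ _++_ X≡ X≡))) (++-assoc (false ∷ Y) (false ∷ Y) [ false ])
  insertBack true with thueMorse-head k true
  ... | Z̄″ , Z̄≡ = subst ContainsOverlap (sym W++≡) (square-∷ʳ-overlap (X ++ Z ++ Z) true Z̄″)
    where
    regroup : ∀ (X Z Z̄ T : Word) → (X ++ Z ++ Z ++ Z̄ ++ Z̄) ++ T ≡ (X ++ Z ++ Z) ++ Z̄ ++ Z̄ ++ T
    regroup X Z Z̄ T = solve (++-monoid Bool)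
    W++≡ : thueMorse k seed ++ [ true ] ≡ (X ++ Z ++ Z) ++ (true ∷ Z̄″) ++ (true ∷ Z̄″) ++ [ true ]
    W++≡ = trans (cong (_++ [ true ]) W≡X++X)
                 (trans (regroup X Z Z̄ [ true ]) (cong (λ z → (X ++ Z ++ Z) ++ z ++ z ++ [ true ]) Z̄≡))

theorem6 : (n : ℕ) → ∃ λ w → n ≤ length w × Extremal w × Irreducible w × Delicate w
theorem6 n =
  W , ≤-trans (m≤n+m n 4) long ,
  (free , λ u v W≡ a → insertions-create-overlap a (insertFront a) (insertBack a) (interior (insert a)) u v W≡) ,
  (free , ≤-trans (s≤s (s≤s (s≤s z≤n))) long , λ u v b W≡ 1≤u 1≤v → interior delete u b v W≡ 1≤u (s≤s 1≤v)) ,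
  (free , ≤-trans (s≤s z≤n) long , λ u v b W≡ → interior flip u b v W≡ tt tt)
  where
  open Seed (3 + n)
  W = thueMorse (3 + n) seed
  long : 4 + n ≤ length W
  long = thueMorse-length (3 + n)
  free : OverlapFree W
  free = thueMorse-overlapFree (3 + n)
  interior : ∀ e u d v → W ≡ u ++ d ∷ v → AwayFromFront e u → AwayFromBack e (d ∷ v) →
             ContainsOverlap (u ++ edit e (d ∷ v))
  interior = μ³-edit-interior (thueMorse n seed) (thueMorse-overlapFree (suc n))
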